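{- Let $\Phi\cup\{\chi\}\subseteq Fm_0$ be a set of propositional (modal-free) formulas. Then $$\square\Phi\vdash_L\square\chi \iff \Phi\vdash_{IPC}\chi,$$ where $\Phi\vdash_{IPC}\chi$ means that $\chi$ is derivable from $\Phi$ in intuitionistic propositional logic.
   Context: Let $V=\{x_0,x_1,x_2,\dots\}$ be an infinite set of propositional variables. The set $Fm$ of formulas is generated from $V$ by the constant $\bot$, the binary connectives $\rightarrow,\vee,\wedge$ and the unary modal operator $\square$; $Fm_0\subseteq Fm$ is the set of formulas not containing $\square$. Abbreviations: $\varphi\leftrightarrow\psi:=(\varphi\rightarrow\psi)\wedge(\psi\rightarrow\varphi)$, $\neg\varphi:=\varphi\rightarrow\bot$, $\top:=\neg\bot$, $\varphi\equiv\psi:=\square(\varphi\rightarrow\psi)\wedge\square(\psi\rightarrow\varphi)$, and $\square\Phi:=\{\square\varphi\mid\varphi\in\Phi\}$. $\varphi[x:=\psi]$ denotes the result of substituting $\psi$ for the variable $x$ in $\varphi$. The logic L is the Hilbert-style system whose axioms are all formulas of the forms: (i) substitution instances (variables replaced by arbitrary formulas of $Fm$) of intuitionistic propositional tautologies; (ii) $\square\varphi\rightarrow\varphi$; (iii) $\square(\varphi\rightarrow\psi)\rightarrow(\square(\psi\rightarrow\chi)\rightarrow\square(\varphi\rightarrow\chi))$; (iv) $\square(\varphi\vee\psi)\rightarrow(\square\varphi\vee\square\psi)$; whose rules are Modus Ponens (from $\varphi$ and $\varphi\rightarrow\psi$ infer $\psi$) and Axiom Necessitation (if $\varphi$ is an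 axiom of form (i)–(iv), infer $\square\varphi$); and which additionally has as theorems (usable in derivations, but not subject to Axiom Necessitation) all formulas $\varphi\vee\neg\varphi$ and all formulas $(\varphi\equiv\psi)\rightarrow(\chi[x:=\varphi]\equiv\chi[x:=\psi])$, for $\varphi,\psi,\chi\in Fm$ and $x\in V$. $\Phi\vdash_L\varphi$ means there is a derivation of $\varphi$ from assumptions $\Phi$ in L. -}

module Defs where

open import Data.Nat using (ℕ; _≡ᵇ_)
open import Data.Bool using (if_then_else_)
open import Data.Product using (Σ; _×_; ∃)
open import Data.Unit using (⊤; tt)
open import Data.Empty using () renaming (⊥ to Empty)
open import Relation.Binary.PropositionalEquality using (_≡_)
open import Function using (_⇔_) public

infixr 6 _∧'_
infixr 5 _∨'_
infixr 4 _⇒_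

data Fm : Set where
  var  : ℕ → Fm
  bot  : Fm
  _⇒_  : Fm → Fm → Fm
  _∨'_ : Fm → Fm → Fm
  _∧'_ : Fm → Fm → Fm
  □    : Fm → Fm

¬' : Fm → Fm
¬' φ = φ ⇒ bot

_≡'_ : Fm → Fm → Fm
φ ≡' ψ = □ (φ ⇒ ψ) ∧' □ (ψ ⇒ φ)

NoBox : Fm → Set
NoBox (var _)  = ⊤
NoBox bot      = ⊤
NoBox (φ ⇒ ψ)  = NoBox φ × NoBox ψ
NoBox (φ ∨' ψ) = NoBox φ × NoBox ψ
NoBox (φ ∧' ψ) = NoBox φ × NoBox ψ
NoBox (□ _)    = Empty

FmSet : Set₁
FmSet = Fm → Set

∅ : FmSet
∅ _ = Empty

□Set : FmSet → FmSet
□Set Φ ψ = Σ Fm (λ φ → Φ φ × ψ ≡ □ φ)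

subst : (ℕ → Fm) → Fm → Fm
subst σ (var x)  = σ x
subst σ bot      = bot
subst σ (φ ⇒ ψ)  = subst σ φ ⇒ subst σ ψ
subst σ (φ ∨' ψ) = subst σ φ ∨' subst σ ψ
subst σ (φ ∧' ψ) = subst σ φ ∧' subst σ ψ
subst σ (□ φ)    = □ (subst σ φ)

_[_≔_] : Fm → ℕ → Fm → Fm
χ [ x ≔ φ ] = subst (λ y → if y ≡ᵇ x then φ else var y) χ

data IPCAxiom : Fm → Set where
  k    : ∀ A B → IPCAxiom (A ⇒ (B ⇒ A))
  s    : ∀ A B C → IPCAxiom ((A ⇒ (B ⇒ C)) ⇒ ((A ⇒ B) ⇒ (A ⇒ C)))
  ∧e₁  : ∀ A B → IPCAxiom ((A ∧' B) ⇒ A)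
  ∧e₂  : ∀ A B → IPCAxiom ((A ∧' B) ⇒ B)
  ∧i   : ∀ A B → IPCAxiom (A ⇒ (B ⇒ (A ∧' B)))
  ∨i₁  : ∀ A B → IPCAxiom (A ⇒ (A ∨' B))
  ∨i₂  : ∀ A B → IPCAxiom (B ⇒ (A ∨' B))
  ∨e   : ∀ A B C → IPCAxiom ((A ⇒ C) ⇒ ((B ⇒ C) ⇒ ((A ∨' B) ⇒ C)))
  efq  : ∀ A → IPCAxiom (bot ⇒ A)

infix 2 _⊢IPC_ _⊢L_

data _⊢IPC_ (Φ : FmSet) : Fm → Set where
  assm : ∀ {φ} → Φ φ → Φ ⊢IPC φ
  ax   : ∀ {φ} → NoBox φ → IPCAxiom φ → Φ ⊢IPC φ
  mp   : ∀ {φ ψ} → Φ ⊢IPC φ → Φ ⊢IPC (φ ⇒ ψ) → Φ ⊢IPC ψ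

IntTaut : Fm → Set
IntTaut t = NoBox t × (∅ ⊢IPC t)

data LAxiom : Fm → Set where
  taut  : ∀ (σ : ℕ → Fm) t → IntTaut t → LAxiom (subst σ t)
  refl□ : ∀ φ → LAxiom (□ φ ⇒ φ)
  trans□ : ∀ φ ψ χ → LAxiom (□ (φ ⇒ ψ) ⇒ (□ (ψ ⇒ χ) ⇒ □ (φ ⇒ χ)))
  disj□ : ∀ φ ψ → LAxiom (□ (φ ∨' ψ) ⇒ (□ φ ∨' □ ψ))

data _⊢L_ (Φ : FmSet) : Fm → Set where
  assm : ∀ {φ} → Φ φ → Φ ⊢L φ
  ax   : ∀ {φ} → LAxiom φ → Φ ⊢L φ
  nec  : ∀ {φ} → LAxiom φ → Φ ⊢L □ φ
  lem  : ∀ φ → Φ ⊢L (φ ∨' ¬' φ)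
  sce  : ∀ φ ψ χ x → Φ ⊢L ((φ ≡' ψ) ⇒ ((χ [ x ≔ φ ]) ≡' (χ [ x ≔ ψ ])))
  mp   : ∀ {φ ψ} → Φ ⊢L φ → Φ ⊢L (φ ⇒ ψ) → Φ ⊢L ψ

-- From Φ ⊢IPC χ to □Φ ⊢L □χ: IPC axioms are necessitated tautologies, and modus ponens under □
-- comes from axiom (iii) once □φ is turned into □(⊤ → φ) by the congruence axiom.
--
-- Conversely, read formulas relative to a finite guess (Γ, Δ): the formulas of Γ are taken to be
-- necessary, those of Δ not. The reading ⟦ Γ ⟧ replaces every □a by ⊤ or ⊥ according as the reading
-- of a lies in Γ. By induction on L-derivations, if □Φ ⊢L θ then for every guess deciding the boxes
-- of θ, Φ ∪ Γ proves intuitionistically either a formula of Δ (the guess is refuted) or ¬¬⟦ Γ ⟧ θ;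
-- the double negation absorbs excluded middle. For modus ponens the guess is refined until it also
-- decides the antecedent, by splitting each new box between Γ and Δ and gluing the two branches by
-- cut. For □χ and the empty guess this yields Φ ⊢ χ. Natural deduction over all of Fm is used
-- throughout; erasing boxes turns its derivations into IPC derivations.

module Submission where

open import Defs
open import Data.Bool using (true; false; if_then_else_)
open import Data.Empty using (⊥-elim)
open import Data.List using (List; []; _∷_)
open import Data.List.Relation.Unary.Any using (here; there)
open import Data.Nat as ℕ using (ℕ; _≡ᵇ_)
open import Data.Product using (Σ; _×_; _,_; proj₁; proj₂; uncurry)
open import Data.Unit using (⊤)
open import Data.Sum using (_⊎_; inj₁; inj₂; [_,_]′; map₁)
open import Function using (_∘_; id; mk⇔)
open import Relation.Binary.Definitions using (DecidableEquality)
open import Relation.Binary.PropositionalEquality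
  using (_≡_; refl; sym; trans; cong; cong₂) renaming (subst to transport)
open import Relation.Nullary using (Dec; yes; no; ¬_)
open import Relation.Nullary.Decidable using (map′; _×-dec_)
open import Relation.Unary using (_⊆_; _∪_; ｛_｝)

infix 4 _≟_
_≟_ : DecidableEquality Fm
var x ≟ var y = map′ (cong var) (λ { refl → refl }) (x ℕ.≟ y)
bot ≟ bot = yes refl
(a ⇒ b) ≟ (c ⇒ d) =
  map′ (uncurry (cong₂ _⇒_)) (λ { refl → refl , refl }) (a ≟ c ×-dec b ≟ d)
(a ∨' b) ≟ (c ∨' d) =
  map′ (uncurry (cong₂ _∨'_)) (λ { refl → refl , refl }) (a ≟ c ×-dec b ≟ d)
(a ∧' b) ≟ (c ∧' d) =
  map′ (uncurry (cong₂ _∧'_)) (λ { refl → refl , refl }) (a ≟ c ×-dec b ≟ d)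
□ a ≟ □ c = map′ (cong □) (λ { refl → refl }) (a ≟ c)
var _ ≟ bot = no λ ()
var _ ≟ (_ ⇒ _) = no λ ()
var _ ≟ (_ ∨' _) = no λ ()
var _ ≟ (_ ∧' _) = no λ ()
var _ ≟ □ _ = no λ ()
bot ≟ var _ = no λ ()
bot ≟ (_ ⇒ _) = no λ ()
bot ≟ (_ ∨' _) = no λ ()
bot ≟ (_ ∧' _) = no λ ()
bot ≟ □ _ = no λ ()
(_ ⇒ _) ≟ var _ = no λ ()
(_ ⇒ _) ≟ bot = no λ ()
(_ ⇒ _) ≟ (_ ∨' _) = no λ ()
(_ ⇒ _) ≟ (_ ∧' _) = no λ ()
(_ ⇒ _) ≟ □ _ = no λ ()
(_ ∨' _) ≟ var _ = no λ ()
(_ ∨' _) ≟ bot = no λ ()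
(_ ∨' _) ≟ (_ ⇒ _) = no λ ()
(_ ∨' _) ≟ (_ ∧' _) = no λ ()
(_ ∨' _) ≟ □ _ = no λ ()
(_ ∧' _) ≟ var _ = no λ ()
(_ ∧' _) ≟ bot = no λ ()
(_ ∧' _) ≟ (_ ⇒ _) = no λ ()
(_ ∧' _) ≟ (_ ∨' _) = no λ ()
(_ ∧' _) ≟ □ _ = no λ ()
□ _ ≟ var _ = no λ ()
□ _ ≟ bot = no λ ()
□ _ ≟ (_ ⇒ _) = no λ ()
□ _ ≟ (_ ∨' _) = no λ ()
□ _ ≟ (_ ∧' _) = no λ ()

open import Data.List.Membership.DecPropositional _≟_ using (_∈_; _∈?_)

variable
  A B Φ : FmSet
  φ ψ θ : Fm
  Γ Δ : List Fm

⊤' : Fm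
⊤' = ¬' bot

infix 4 _↔'_
_↔'_ : Fm → Fm → Fm
φ ↔' ψ = (φ ⇒ ψ) ∧' (ψ ⇒ φ)

⋁ : List Fm → Fm
⋁ [] = bot
⋁ (φ ∷ Δ) = φ ∨' ⋁ Δ

infixl 3 _,,_
_,,_ : FmSet → Fm → FmSet
A ,, φ = A ∪ ｛ φ ｝

infix 2 _⊢_
data _⊢_ : FmSet → Fm → Set₁ where
  hyp : A φ → A ⊢ φ
  ⇒I  : A ,, φ ⊢ ψ → A ⊢ φ ⇒ ψ
  ⇒E  : A ⊢ φ ⇒ ψ → A ⊢ φ → A ⊢ ψ
  ∧I  : A ⊢ φ → A ⊢ ψ → A ⊢ φ ∧' ψ
  ∧E₁ : A ⊢ φ ∧' ψ → A ⊢ φ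
  ∧E₂ : A ⊢ φ ∧' ψ → A ⊢ ψ
  ∨I₁ : A ⊢ φ → A ⊢ φ ∨' ψ
  ∨I₂ : A ⊢ ψ → A ⊢ φ ∨' ψ
  ∨E  : A ⊢ φ ∨' ψ → A ,, φ ⊢ θ → A ,, ψ ⊢ θ → A ⊢ θ
  ⊥E  : A ⊢ bot → A ⊢ φ

⊢-weaken : A ⊆ B → A ⊢ φ → B ⊢ φ
⊢-weaken f (hyp p) = hyp (f p)
⊢-weaken f (⇒I d) = ⇒I (⊢-weaken (map₁ f) d)
⊢-weaken f (⇒E d e) = ⇒E (⊢-weaken f d) (⊢-weaken f e)
⊢-weaken f (∧I d e) = ∧I (⊢-weaken f d) (⊢-weaken f e)
⊢-weaken f (∧E₁ d) = ∧E₁ (⊢-weaken f d)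
⊢-weaken f (∧E₂ d) = ∧E₂ (⊢-weaken f d)
⊢-weaken f (∨I₁ d) = ∨I₁ (⊢-weaken f d)
⊢-weaken f (∨I₂ d) = ∨I₂ (⊢-weaken f d)
⊢-weaken f (∨E d e g) = ∨E (⊢-weaken f d) (⊢-weaken (map₁ f) e) (⊢-weaken (map₁ f) g)
⊢-weaken f (⊥E d) = ⊥E (⊢-weaken f d)

⊢-wk : A ⊢ φ → A ,, ψ ⊢ φ
⊢-wk = ⊢-weaken inj₁

#0 : A ,, φ ⊢ φ
#0 = hyp (inj₂ refl)

#1 : A ,, φ ,, ψ ⊢ φ
#1 = ⊢-wk #0

#2 : A ,, φ ,, ψ ,, θ ⊢ φ
#2 = ⊢-wk #1

⊤-intro : A ⊢ ⊤'
⊤-intro = ⇒I #0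

¬¬-intro : A ⊢ φ → A ⊢ ¬' (¬' φ)
¬¬-intro d = ⇒I (⇒E #0 (⊢-wk d))

¬¬-mp : A ⊢ ¬' (¬' φ) → A ⊢ ¬' (¬' (φ ⇒ ψ)) → A ⊢ ¬' (¬' ψ)
¬¬-mp nnφ nnf =
  ⇒I (⇒E (⊢-wk nnf) (⇒I (⇒E (⊢-wk (⊢-wk nnφ)) (⇒I (⇒E #2 (⇒E #1 #0))))))

¬¬-lem : A ⊢ ¬' (¬' (φ ∨' ¬' φ))
¬¬-lem = ⇒I (⇒E #0 (∨I₂ (⇒I (⇒E #1 (∨I₁ #0)))))

⇒-trans : A ⊢ φ ⇒ ψ → A ⊢ ψ ⇒ θ → A ⊢ φ ⇒ θ
⇒-trans f g = ⇒I (⇒E (⊢-wk g) (⇒E (⊢-wk f) #0))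

⋁-intro : φ ∈ Δ → A ⊢ φ → A ⊢ ⋁ Δ
⋁-intro (here refl) d = ∨I₁ d
⋁-intro (there p) d = ∨I₂ (⋁-intro p d)

∨-map : A ⊢ φ ∨' ψ → A ,, ψ ⊢ θ → A ⊢ φ ∨' θ
∨-map d f = ∨E d (∨I₁ #0) (∨I₂ f)

∨-map₂ : ∀ {ψ₁ ψ₂} → A ⊢ φ ∨' ψ₁ → A ⊢ φ ∨' ψ₂ → A ,, ψ₁ ,, ψ₂ ⊢ θ → A ⊢ φ ∨' θ
∨-map₂ d e f = ∨E d (∨I₁ #0) (∨-map (⊢-wk e) f)

∨-absorb : A ⊢ φ ∨' ψ → A ,, ψ ⊢ φ → A ⊢ φ ∨' θ
∨-absorb d f = ∨E d (∨I₁ #0) (∨I₁ f)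

↔-refl : A ⊢ φ ↔' φ
↔-refl = ∧I (⇒I #0) (⇒I #0)

module _ {p₁ p₂ q₁ q₂ : Fm} where

  ↔-cong-⇒ : A ,, p₁ ↔' p₂ ,, q₁ ↔' q₂ ⊢ (p₁ ⇒ q₁) ↔' (p₂ ⇒ q₂)
  ↔-cong-⇒ = ∧I (⇒I (⇒I (⇒E (∧E₁ #2) (⇒E #1 (⇒E (∧E₂ (⊢-wk #2)) #0)))))
                (⇒I (⇒I (⇒E (∧E₂ #2) (⇒E #1 (⇒E (∧E₁ (⊢-wk #2)) #0)))))

  ↔-cong-∨ : A ,, p₁ ↔' p₂ ,, q₁ ↔' q₂ ⊢ (p₁ ∨' q₁) ↔' (p₂ ∨' q₂)
  ↔-cong-∨ = ∧I (⇒I (∨E #0 (∨I₁ (⇒E (∧E₁ (⊢-wk #2)) #0)) (∨I₂ (⇒E (∧E₁ #2) #0))))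
                (⇒I (∨E #0 (∨I₁ (⇒E (∧E₂ (⊢-wk #2)) #0)) (∨I₂ (⇒E (∧E₂ #2) #0))))

  ↔-cong-∧ : A ,, p₁ ↔' p₂ ,, q₁ ↔' q₂ ⊢ (p₁ ∧' q₁) ↔' (p₂ ∧' q₂)
  ↔-cong-∧ = ∧I (⇒I (∧I (⇒E (∧E₁ #2) (∧E₁ #0)) (⇒E (∧E₁ #1) (∧E₂ #0))))
                (⇒I (∧I (⇒E (∧E₂ #2) (∧E₁ #0)) (⇒E (∧E₂ #1) (∧E₂ #0))))

IPCAxiom-⊢ : (σ : ℕ → Fm) → IPCAxiom φ → A ⊢ subst σ φ
IPCAxiom-⊢ σ (k _ _) = ⇒I (⇒I #1)
IPCAxiom-⊢ σ (s _ _ _) = ⇒I (⇒I (⇒I (⇒E (⇒E #2 #0) (⇒E #1 #0))))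
IPCAxiom-⊢ σ (∧e₁ _ _) = ⇒I (∧E₁ #0)
IPCAxiom-⊢ σ (∧e₂ _ _) = ⇒I (∧E₂ #0)
IPCAxiom-⊢ σ (∧i _ _) = ⇒I (⇒I (∧I #1 #0))
IPCAxiom-⊢ σ (∨i₁ _ _) = ⇒I (∨I₁ #0)
IPCAxiom-⊢ σ (∨i₂ _ _) = ⇒I (∨I₂ #0)
IPCAxiom-⊢ σ (∨e _ _ _) = ⇒I (⇒I (⇒I (∨E #0 (⇒E (⊢-wk #2) #0) (⇒E #2 #0))))
IPCAxiom-⊢ σ (efq _) = ⇒I (⊥E #0)

IPC-theorem-⊢ : (σ : ℕ → Fm) → ∅ ⊢IPC φ → A ⊢ subst σ φ
IPC-theorem-⊢ σ (assm ())
IPC-theorem-⊢ σ (ax _ a) = IPCAxiom-⊢ σ a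
IPC-theorem-⊢ σ (mp d e) = ⇒E (IPC-theorem-⊢ σ e) (IPC-theorem-⊢ σ d)

NoBoxSet : FmSet → Set
NoBoxSet B = ∀ φ → B φ → NoBox φ

,,-noBox : NoBoxSet B → NoBox φ → NoBoxSet (B ,, φ)
,,-noBox nb nφ _ (inj₁ p) = nb _ p
,,-noBox nb nφ _ (inj₂ refl) = nφ

⊢IPC-noBox : NoBoxSet B → B ⊢IPC φ → NoBox φ
⊢IPC-noBox nb (assm p) = nb _ p
⊢IPC-noBox nb (ax n _) = n
⊢IPC-noBox nb (mp d e) = proj₂ (⊢IPC-noBox nb e)

⊢IPC-weaken : A ⊆ B → A ⊢IPC φ → B ⊢IPC φ
⊢IPC-weaken f (assm p) = assm (f p)
⊢IPC-weaken f (ax n a) = ax n a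
⊢IPC-weaken f (mp d e) = mp (⊢IPC-weaken f d) (⊢IPC-weaken f e)

⊢IPC-id : NoBox φ → B ⊢IPC φ ⇒ φ
⊢IPC-id {φ} n =
  mp (ax (n , n , n) (k φ φ))
     (mp (ax (n , (n , n) , n) (k φ (φ ⇒ φ)))
         (ax ((n , (n , n) , n) , (n , n , n) , n , n) (s φ (φ ⇒ φ) φ)))

deduction : NoBoxSet B → NoBox φ → B ,, φ ⊢IPC ψ → B ⊢IPC φ ⇒ ψ
deduction nb nφ (assm (inj₁ p)) = mp (assm p) (ax (nb _ p , nφ , nb _ p) (k _ _))
deduction nb nφ (assm (inj₂ refl)) = ⊢IPC-id nφ
deduction nb nφ (ax n a) = mp (ax n a) (ax (n , nφ , n) (k _ _))
deduction {φ = φ} nb nφ (mp {θ} {ψ} d e) =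
  mp (deduction nb nφ d)
     (mp (deduction nb nφ e) (ax ((nφ , nθ , nψ) , (nφ , nθ) , (nφ , nψ)) (s φ θ ψ)))
  where
  nθ = ⊢IPC-noBox (,,-noBox nb nφ) d
  nψ = proj₂ (⊢IPC-noBox (,,-noBox nb nφ) e)

erase : Fm → Fm
erase (var x) = var x
erase bot = bot
erase (φ ⇒ ψ) = erase φ ⇒ erase ψ
erase (φ ∨' ψ) = erase φ ∨' erase ψ
erase (φ ∧' ψ) = erase φ ∧' erase ψ
erase (□ φ) = erase φ

erase-noBox : ∀ φ → NoBox (erase φ)
erase-noBox (var x) = _
erase-noBox bot = _
erase-noBox (φ ⇒ ψ) = erase-noBox φ , erase-noBox ψ
erase-noBox (φ ∨' ψ) = erase-noBox φ , erase-noBox ψ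
erase-noBox (φ ∧' ψ) = erase-noBox φ , erase-noBox ψ
erase-noBox (□ φ) = erase-noBox φ

erase-noBox-id : NoBox φ → erase φ ≡ φ
erase-noBox-id {var x} _ = refl
erase-noBox-id {bot} _ = refl
erase-noBox-id {φ ⇒ ψ} (p , q) = cong₂ _⇒_ (erase-noBox-id p) (erase-noBox-id q)
erase-noBox-id {φ ∨' ψ} (p , q) = cong₂ _∨'_ (erase-noBox-id p) (erase-noBox-id q)
erase-noBox-id {φ ∧' ψ} (p , q) = cong₂ _∧'_ (erase-noBox-id p) (erase-noBox-id q)

Erases : FmSet → FmSet → Set
Erases A B = ∀ {φ} → A φ → B ⊢IPC erase φ

erased-axiom : ∀ φ → IPCAxiom (erase φ) → B ⊢IPC erase φ
erased-axiom φ = ax (erase-noBox φ)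

⊢⇒⊢IPC : NoBoxSet B → Erases A B → A ⊢ φ → B ⊢IPC erase φ
⊢⇒⊢IPC-discharge : NoBoxSet B → Erases A B → A ,, φ ⊢ ψ → B ⊢IPC erase (φ ⇒ ψ)

⊢⇒⊢IPC nb H (hyp p) = H p
⊢⇒⊢IPC nb H (⇒I d) = ⊢⇒⊢IPC-discharge nb H d
⊢⇒⊢IPC nb H (⇒E d e) = mp (⊢⇒⊢IPC nb H e) (⊢⇒⊢IPC nb H d)
⊢⇒⊢IPC nb H (∧I {φ = φ} {ψ} d e) =
  mp (⊢⇒⊢IPC nb H e) (mp (⊢⇒⊢IPC nb H d) (erased-axiom (φ ⇒ ψ ⇒ φ ∧' ψ) (∧i _ _)))
⊢⇒⊢IPC nb H (∧E₁ {φ = φ} {ψ} d) =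
  mp (⊢⇒⊢IPC nb H d) (erased-axiom (φ ∧' ψ ⇒ φ) (∧e₁ _ _))
⊢⇒⊢IPC nb H (∧E₂ {φ = φ} {ψ} d) =
  mp (⊢⇒⊢IPC nb H d) (erased-axiom (φ ∧' ψ ⇒ ψ) (∧e₂ _ _))
⊢⇒⊢IPC nb H (∨I₁ {φ = φ} {ψ} d) =
  mp (⊢⇒⊢IPC nb H d) (erased-axiom (φ ⇒ φ ∨' ψ) (∨i₁ _ _))
⊢⇒⊢IPC nb H (∨I₂ {ψ = ψ} {φ = φ} d) =
  mp (⊢⇒⊢IPC nb H d) (erased-axiom (ψ ⇒ φ ∨' ψ) (∨i₂ _ _))
⊢⇒⊢IPC nb H (∨E {φ = φ} {ψ} {θ} d e f) =
  mp (⊢⇒⊢IPC nb H d) (mp (⊢⇒⊢IPC-discharge nb H f) (mp (⊢⇒⊢IPC-discharge nb H e)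
    (erased-axiom ((φ ⇒ θ) ⇒ (ψ ⇒ θ) ⇒ φ ∨' ψ ⇒ θ) (∨e _ _ _))))
⊢⇒⊢IPC nb H (⊥E {φ = φ} d) = mp (⊢⇒⊢IPC nb H d) (erased-axiom (bot ⇒ φ) (efq _))

⊢⇒⊢IPC-discharge {B} {A} {φ} nb H d =
  deduction nb (erase-noBox φ) (⊢⇒⊢IPC (,,-noBox nb (erase-noBox φ)) H′ d)
  where
  H′ : Erases (A ,, φ) (B ,, erase φ)
  H′ (inj₁ p) = ⊢IPC-weaken inj₁ (H p)
  H′ (inj₂ refl) = assm (inj₂ refl)

fromDec : ∀ {P : Set} → Dec P → Fm
fromDec (yes _) = ⊤'
fromDec (no _) = bot

⟦_⟧ : List Fm → Fm → Fm
⟦ Γ ⟧ (var x) = var x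
⟦ Γ ⟧ bot = bot
⟦ Γ ⟧ (φ ⇒ ψ) = ⟦ Γ ⟧ φ ⇒ ⟦ Γ ⟧ ψ
⟦ Γ ⟧ (φ ∨' ψ) = ⟦ Γ ⟧ φ ∨' ⟦ Γ ⟧ ψ
⟦ Γ ⟧ (φ ∧' ψ) = ⟦ Γ ⟧ φ ∧' ⟦ Γ ⟧ ψ
⟦ Γ ⟧ (□ φ) = fromDec (⟦ Γ ⟧ φ ∈? Γ)

Decided : List Fm → List Fm → Fm → Set
Decided Γ Δ (var x) = ⊤
Decided Γ Δ bot = ⊤
Decided Γ Δ (φ ⇒ ψ) = Decided Γ Δ φ × Decided Γ Δ ψ
Decided Γ Δ (φ ∨' ψ) = Decided Γ Δ φ × Decided Γ Δ ψ
Decided Γ Δ (φ ∧' ψ) = Decided Γ Δ φ × Decided Γ Δ ψ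
Decided Γ Δ (□ φ) = Decided Γ Δ φ × (⟦ Γ ⟧ φ ∈ Γ ⊎ ⟦ Γ ⟧ φ ∈ Δ)

Clash : List Fm → List Fm → Set
Clash Γ Δ = Σ Fm λ φ → φ ∈ Γ × φ ∈ Δ

⟦⟧-noBox : NoBox φ → ⟦ Γ ⟧ φ ≡ φ
⟦⟧-noBox {var x} _ = refl
⟦⟧-noBox {bot} _ = refl
⟦⟧-noBox {φ ⇒ ψ} (p , q) = cong₂ _⇒_ (⟦⟧-noBox p) (⟦⟧-noBox q)
⟦⟧-noBox {φ ∨' ψ} (p , q) = cong₂ _∨'_ (⟦⟧-noBox p) (⟦⟧-noBox q)
⟦⟧-noBox {φ ∧' ψ} (p , q) = cong₂ _∧'_ (⟦⟧-noBox p) (⟦⟧-noBox q)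

Decided-noBox : NoBox φ → Decided Γ Δ φ
Decided-noBox {var x} _ = _
Decided-noBox {bot} _ = _
Decided-noBox {φ ⇒ ψ} (p , q) = Decided-noBox p , Decided-noBox q
Decided-noBox {φ ∨' ψ} (p , q) = Decided-noBox p , Decided-noBox q
Decided-noBox {φ ∧' ψ} (p , q) = Decided-noBox p , Decided-noBox q

⟦⟧-subst : ∀ (σ : ℕ → Fm) φ → NoBox φ → ⟦ Γ ⟧ (subst σ φ) ≡ subst (⟦ Γ ⟧ ∘ σ) φ
⟦⟧-subst σ (var x) _ = refl
⟦⟧-subst σ bot _ = refl
⟦⟧-subst σ (φ ⇒ ψ) (p , q) = cong₂ _⇒_ (⟦⟧-subst σ φ p) (⟦⟧-subst σ ψ q)
⟦⟧-subst σ (φ ∨' ψ) (p , q) = cong₂ _∨'_ (⟦⟧-subst σ φ p) (⟦⟧-subst σ ψ q)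
⟦⟧-subst σ (φ ∧' ψ) (p , q) = cong₂ _∧'_ (⟦⟧-subst σ φ p) (⟦⟧-subst σ ψ q)

resolve : φ ∈ Γ ⊎ φ ∈ Δ → ¬ φ ∈ Γ → φ ∈ Δ
resolve p φ∉Γ = [ ⊥-elim ∘ φ∉Γ , id ]′ p

infix 4 _⊑_
_⊑_ : List Fm × List Fm → List Fm × List Fm → Set
(Γ , Δ) ⊑ (Γ′ , Δ′) = (∀ {φ} → φ ∈ Γ → φ ∈ Γ′) × (∀ {φ} → φ ∈ Δ → φ ∈ Δ′)

⊑-trans : ∀ {Γ₁ Δ₁ Γ₂ Δ₂} →
  (Γ , Δ) ⊑ (Γ₁ , Δ₁) → (Γ₁ , Δ₁) ⊑ (Γ₂ , Δ₂) → (Γ , Δ) ⊑ (Γ₂ , Δ₂)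
⊑-trans (s₁ , t₁) (s₂ , t₂) = s₂ ∘ s₁ , t₂ ∘ t₁

module _ {Γ Δ Γ′ Δ′ : List Fm} (ext : (Γ , Δ) ⊑ (Γ′ , Δ′)) where

  Persists : Fm → Set
  Persists φ = Clash Γ′ Δ′ ⊎ (Decided Γ′ Δ′ φ × ⟦ Γ′ ⟧ φ ≡ ⟦ Γ ⟧ φ)

  private
    persists₂ : ∀ (_∙_ : Fm → Fm → Fm) {φ ψ} → Persists φ → Persists ψ →
      Clash Γ′ Δ′ ⊎ ((Decided Γ′ Δ′ φ × Decided Γ′ Δ′ ψ) ×
                     (⟦ Γ′ ⟧ φ ∙ ⟦ Γ′ ⟧ ψ) ≡ (⟦ Γ ⟧ φ ∙ ⟦ Γ ⟧ ψ))
    persists₂ _ (inj₁ c) _ = inj₁ c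
    persists₂ _ (inj₂ _) (inj₁ c) = inj₁ c
    persists₂ _∙_ (inj₂ (dφ , eφ)) (inj₂ (dψ , eψ)) =
      inj₂ ((dφ , dψ) , cong₂ _∙_ eφ eψ)

    persists-∈ : ∀ φ → φ ∈ Γ ⊎ φ ∈ Δ →
      Clash Γ′ Δ′ ⊎ ((φ ∈ Γ′ ⊎ φ ∈ Δ′) × fromDec (φ ∈? Γ′) ≡ fromDec (φ ∈? Γ))
    persists-∈ φ p with φ ∈? Γ′ | φ ∈? Γ
    ... | yes φ∈Γ′ | yes _ = inj₂ (inj₁ φ∈Γ′ , refl)
    ... | yes φ∈Γ′ | no φ∉Γ = inj₁ (φ , φ∈Γ′ , proj₂ ext (resolve p φ∉Γ))
    ... | no φ∉Γ′ | yes φ∈Γ = ⊥-elim (φ∉Γ′ (proj₁ ext φ∈Γ))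
    ... | no _ | no φ∉Γ = inj₂ (inj₂ (proj₂ ext (resolve p φ∉Γ)) , refl)

  persistence : ∀ φ → Decided Γ Δ φ → Persists φ
  persistence (var x) _ = inj₂ (_ , refl)
  persistence bot _ = inj₂ (_ , refl)
  persistence (φ ⇒ ψ) (dφ , dψ) = persists₂ _⇒_ (persistence φ dφ) (persistence ψ dψ)
  persistence (φ ∨' ψ) (dφ , dψ) = persists₂ _∨'_ (persistence φ dφ) (persistence ψ dψ)
  persistence (φ ∧' ψ) (dφ , dψ) = persists₂ _∧'_ (persistence φ dφ) (persistence ψ dψ)
  persistence (□ φ) (dφ , p) with persistence φ dφ
  ... | inj₁ c = inj₁ c
  ... | inj₂ (dφ′ , e) rewrite e with persists-∈ (⟦ Γ ⟧ φ) p
  ...   | inj₁ c = inj₁ c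
  ...   | inj₂ (p′ , e′) = inj₂ ((dφ′ , p′) , e′)

module Extension (S : List Fm → List Fm → Set₁)
  (cut : ∀ {Γ Δ} φ → S (φ ∷ Γ) Δ → S Γ (φ ∷ Δ) → S Γ Δ)
  (clash : ∀ {Γ Δ} → Clash Γ Δ → S Γ Δ) where

  extend : ∀ θ Γ Δ → (∀ Γ′ Δ′ → (Γ , Δ) ⊑ (Γ′ , Δ′) → Decided Γ′ Δ′ θ → S Γ′ Δ′) → S Γ Δ
  extend₂ : ∀ φ ψ Γ Δ →
    (∀ Γ′ Δ′ → (Γ , Δ) ⊑ (Γ′ , Δ′) → Decided Γ′ Δ′ φ × Decided Γ′ Δ′ ψ → S Γ′ Δ′) → S Γ Δ

  extend (var x) Γ Δ H = H Γ Δ (id , id) _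
  extend bot Γ Δ H = H Γ Δ (id , id) _
  extend (φ ⇒ ψ) = extend₂ φ ψ
  extend (φ ∨' ψ) = extend₂ φ ψ
  extend (φ ∧' ψ) = extend₂ φ ψ
  extend (□ φ) Γ Δ H =
    extend φ Γ Δ λ Γ₁ Δ₁ ext₁ dφ →
    cut (⟦ Γ₁ ⟧ φ)
      ([ clash , (λ (dφ′ , e) → H _ _ (⊑-trans ext₁ (there , id)) (dφ′ , inj₁ (here e))) ]′
        (persistence (there , id) φ dφ))
      ([ clash , (λ (dφ′ , e) → H _ _ (⊑-trans ext₁ (id , there)) (dφ′ , inj₂ (here e))) ]′
        (persistence (id , there) φ dφ))

  extend₂ φ ψ Γ Δ H =
    extend φ Γ Δ λ Γ₁ Δ₁ ext₁ dφ →
    extend ψ Γ₁ Δ₁ λ Γ₂ Δ₂ ext₂ dψ →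
    [ clash , (λ (dφ′ , _) → H Γ₂ Δ₂ (⊑-trans ext₁ ext₂) (dφ′ , dψ)) ]′
      (persistence ext₂ φ dφ)

module Soundness (Φ : FmSet) (Φ-noBox : NoBoxSet Φ) where

  Φ⁺ : List Fm → FmSet
  Φ⁺ Γ = Φ ∪ (_∈ Γ)

  infix 2 _∣_⊢_ _∣_⊩_
  _∣_⊢_ : List Fm → List Fm → Fm → Set₁
  Γ ∣ Δ ⊢ φ = Φ⁺ Γ ⊢ ⋁ Δ ∨' φ

  _∣_⊩_ : List Fm → List Fm → Fm → Set₁
  Γ ∣ Δ ⊩ φ = Γ ∣ Δ ⊢ ¬' (¬' φ)

  Valid : Fm → Set₁
  Valid θ = ∀ Γ Δ → Decided Γ Δ θ → Γ ∣ Δ ⊩ ⟦ Γ ⟧ θ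

  hypΓ : φ ∈ Γ → Φ⁺ Γ ⊢ φ
  hypΓ = hyp ∘ inj₂

  ⊩-intro : Γ ∣ Δ ⊢ φ → Γ ∣ Δ ⊩ φ
  ⊩-intro d = ∨-map d (¬¬-intro #0)

  ⊩-mp : Γ ∣ Δ ⊩ φ → Γ ∣ Δ ⊩ φ ⇒ ψ → Γ ∣ Δ ⊩ ψ
  ⊩-mp d e = ∨-map₂ d e (¬¬-mp #1 #0)

  ⊩-clash : Clash Γ Δ → Γ ∣ Δ ⊩ φ
  ⊩-clash (_ , p , q) = ∨I₁ (⋁-intro q (hypΓ p))

  ⊩-cut : ∀ θ → θ ∷ Γ ∣ Δ ⊩ φ → Γ ∣ θ ∷ Δ ⊩ φ → Γ ∣ Δ ⊩ φ
  ⊩-cut {Γ} {Δ} θ d e = ∨E e (∨E #0 (⊢-weaken move d) (∨I₁ #0)) (∨I₂ #0)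
    where
    move : Φ⁺ (θ ∷ Γ) ⊆ (Φ⁺ Γ ,, θ ∨' ⋁ Δ ,, θ)
    move (inj₁ p) = inj₁ (inj₁ (inj₁ p))
    move (inj₂ (here refl)) = inj₂ refl
    move (inj₂ (there p)) = inj₁ (inj₁ (inj₂ p))

  box-intro : φ ∈ Γ ⊎ φ ∈ Δ → Γ ∣ Δ ⊢ φ → Γ ∣ Δ ⊢ fromDec (φ ∈? Γ)
  box-intro {φ} {Γ} p d with φ ∈? Γ
  ... | yes _ = ∨I₂ ⊤-intro
  ... | no φ∉Γ = ∨-absorb d (⋁-intro (resolve p φ∉Γ) #0)

  refl□-valid : ∀ φ → Γ ∣ Δ ⊢ fromDec (φ ∈? Γ) ⇒ φ
  refl□-valid {Γ} φ with φ ∈? Γ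
  ... | yes φ∈Γ = ∨I₂ (⇒I (⊢-wk (hypΓ φ∈Γ)))
  ... | no _ = ∨I₂ (⇒I (⊥E #0))

  trans□-valid : ∀ φ ψ θ → (φ ⇒ θ) ∈ Γ ⊎ (φ ⇒ θ) ∈ Δ →
    Γ ∣ Δ ⊢ fromDec ((φ ⇒ ψ) ∈? Γ) ⇒ fromDec ((ψ ⇒ θ) ∈? Γ) ⇒ fromDec ((φ ⇒ θ) ∈? Γ)
  trans□-valid {Γ} φ ψ θ p with (φ ⇒ ψ) ∈? Γ | (ψ ⇒ θ) ∈? Γ | (φ ⇒ θ) ∈? Γ
  ... | _ | _ | yes _ = ∨I₂ (⇒I (⇒I ⊤-intro))
  ... | no _ | _ | no _ = ∨I₂ (⇒I (⊥E #0))
  ... | yes _ | no _ | no _ = ∨I₂ (⇒I (⇒I (⊥E #0)))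
  ... | yes φψ | yes ψθ | no φθ∉Γ =
    ∨I₁ (⋁-intro (resolve p φθ∉Γ) (⇒-trans (hypΓ φψ) (hypΓ ψθ)))

  disj□-valid : ∀ φ ψ → φ ∈ Γ ⊎ φ ∈ Δ → ψ ∈ Γ ⊎ ψ ∈ Δ →
    Γ ∣ Δ ⊢ fromDec ((φ ∨' ψ) ∈? Γ) ⇒ fromDec (φ ∈? Γ) ∨' fromDec (ψ ∈? Γ)
  disj□-valid {Γ} φ ψ p q with (φ ∨' ψ) ∈? Γ | φ ∈? Γ | ψ ∈? Γ
  ... | no _ | _ | _ = ∨I₂ (⇒I (⊥E #0))
  ... | yes _ | yes _ | _ = ∨I₂ (⇒I (∨I₁ ⊤-intro))
  ... | yes _ | no _ | yes _ = ∨I₂ (⇒I (∨I₂ ⊤-intro))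
  ... | yes φ∨ψ | no φ∉Γ | no ψ∉Γ =
    ∨I₁ (∨E (hypΓ φ∨ψ) (⋁-intro (resolve p φ∉Γ) #0) (⋁-intro (resolve q ψ∉Γ) #0))

  box-cong : ∀ φ ψ → φ ∈ Γ ⊎ φ ∈ Δ → ψ ∈ Γ ⊎ ψ ∈ Δ →
    Γ ∣ Δ ⊢ φ ↔' ψ → Γ ∣ Δ ⊢ fromDec (φ ∈? Γ) ↔' fromDec (ψ ∈? Γ)
  box-cong {Γ} φ ψ p q d with φ ∈? Γ | ψ ∈? Γ
  ... | yes _ | yes _ = ∨I₂ ↔-refl
  ... | no _ | no _ = ∨I₂ ↔-refl
  ... | yes φ∈Γ | no ψ∉Γ =
    ∨-absorb d (⋁-intro (resolve q ψ∉Γ) (⇒E (∧E₁ #0) (⊢-wk (hypΓ φ∈Γ))))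
  ... | no φ∉Γ | yes ψ∈Γ =
    ∨-absorb d (⋁-intro (resolve p φ∉Γ) (⇒E (∧E₂ #0) (⊢-wk (hypΓ ψ∈Γ))))

  subst-cong : ∀ (σ τ : ℕ → Fm) χ → (∀ y → Γ ∣ Δ ⊢ ⟦ Γ ⟧ (σ y) ↔' ⟦ Γ ⟧ (τ y)) →
    Decided Γ Δ (subst σ χ) → Decided Γ Δ (subst τ χ) →
    Γ ∣ Δ ⊢ ⟦ Γ ⟧ (subst σ χ) ↔' ⟦ Γ ⟧ (subst τ χ)
  subst-cong σ τ (var y) e _ _ = e y
  subst-cong σ τ bot e _ _ = ∨I₂ ↔-refl
  subst-cong σ τ (φ ⇒ ψ) e (dσφ , dσψ) (dτφ , dτψ) =
    ∨-map₂ (subst-cong σ τ φ e dσφ dτφ) (subst-cong σ τ ψ e dσψ dτψ) ↔-cong-⇒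
  subst-cong σ τ (φ ∨' ψ) e (dσφ , dσψ) (dτφ , dτψ) =
    ∨-map₂ (subst-cong σ τ φ e dσφ dτφ) (subst-cong σ τ ψ e dσψ dτψ) ↔-cong-∨
  subst-cong σ τ (φ ∧' ψ) e (dσφ , dσψ) (dτφ , dτψ) =
    ∨-map₂ (subst-cong σ τ φ e dσφ dτφ) (subst-cong σ τ ψ e dσψ dτψ) ↔-cong-∧
  subst-cong σ τ (□ φ) e (dσφ , p) (dτφ , q) =
    box-cong _ _ p q (subst-cong σ τ φ e dσφ dτφ)

  ≔-cong : ∀ x → Φ⁺ Γ ⊢ ⟦ Γ ⟧ φ ↔' ⟦ Γ ⟧ ψ → ∀ y →
    Γ ∣ Δ ⊢ ⟦ Γ ⟧ (if y ≡ᵇ x then φ else var y) ↔' ⟦ Γ ⟧ (if y ≡ᵇ x then ψ else var y)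
  ≔-cong x e y with y ≡ᵇ x
  ... | true = ∨I₂ e
  ... | false = ∨I₂ ↔-refl

  sce-valid : ∀ φ ψ u w → (u ⇒ w) ∈ Γ ⊎ (u ⇒ w) ∈ Δ → (w ⇒ u) ∈ Γ ⊎ (w ⇒ u) ∈ Δ →
    (Φ⁺ Γ ⊢ φ ↔' ψ → Γ ∣ Δ ⊢ u ↔' w) →
    Γ ∣ Δ ⊢ fromDec ((φ ⇒ ψ) ∈? Γ) ∧' fromDec ((ψ ⇒ φ) ∈? Γ) ⇒
            fromDec ((u ⇒ w) ∈? Γ) ∧' fromDec ((w ⇒ u) ∈? Γ)
  sce-valid {Γ} {Δ} φ ψ u w p q congruence with (φ ⇒ ψ) ∈? Γ | (ψ ⇒ φ) ∈? Γ
  ... | no _ | _ = ∨I₂ (⇒I (⊥E (∧E₁ #0)))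
  ... | yes _ | no _ = ∨I₂ (⇒I (⊥E (∧E₂ #0)))
  ... | yes φψ | yes ψφ =
    ∨-map (∨-map₂ (box-intro p (∨-map u↔w (∧E₁ #0))) (box-intro q (∨-map u↔w (∧E₂ #0))) (∧I #1 #0))
          (⇒I (⊢-wk #0))
    where
    u↔w : Γ ∣ Δ ⊢ u ↔' w
    u↔w = congruence (∧I (hypΓ φψ) (hypΓ ψφ))

  axiom-valid : LAxiom θ → ∀ Γ Δ → Decided Γ Δ θ → Γ ∣ Δ ⊢ ⟦ Γ ⟧ θ
  axiom-valid (taut σ t (nt , d)) Γ Δ _ =
    ∨I₂ (transport (Φ⁺ Γ ⊢_) (sym (⟦⟧-subst σ t nt)) (IPC-theorem-⊢ (⟦ Γ ⟧ ∘ σ) d))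
  axiom-valid (refl□ φ) Γ Δ _ = refl□-valid (⟦ Γ ⟧ φ)
  axiom-valid (trans□ φ ψ θ) Γ Δ (_ , _ , _ , p) = trans□-valid _ _ _ p
  axiom-valid (disj□ φ ψ) Γ Δ (_ , (_ , p) , (_ , q)) = disj□-valid _ _ p q

  soundness : □Set Φ ⊢L θ → Valid θ
  soundness (assm (φ , Φφ , refl)) Γ Δ (_ , p) =
    ⊩-intro (box-intro p (∨I₂ (transport (Φ⁺ Γ ⊢_) (sym (⟦⟧-noBox (Φ-noBox φ Φφ))) (hyp (inj₁ Φφ)))))
  soundness (ax a) Γ Δ d = ⊩-intro (axiom-valid a Γ Δ d)
  soundness (nec a) Γ Δ (d , p) = ⊩-intro (box-intro p (axiom-valid a Γ Δ d))
  soundness (lem φ) Γ Δ _ = ∨I₂ ¬¬-lem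
  soundness (sce φ ψ χ x) Γ Δ (_ , ((dχφ , dχψ) , p) , (_ , q)) =
    ⊩-intro (sce-valid _ _ _ _ p q λ e → subst-cong _ _ χ (≔-cong x e) dχφ dχψ)
  soundness (mp {φ} {ψ} d e) Γ Δ dψ =
    extend φ Γ Δ λ Γ′ Δ′ ext dφ →
      [ ⊩-clash
      , (λ (dψ′ , ⟦ψ⟧≡) → transport (Γ′ ∣ Δ′ ⊩_) ⟦ψ⟧≡
          (⊩-mp (soundness d Γ′ Δ′ dφ) (soundness e Γ′ Δ′ (dφ , dψ′))))
      ]′ (persistence ext ψ dψ)
    where open Extension (λ Γ′ Δ′ → Γ′ ∣ Δ′ ⊩ ⟦ Γ ⟧ ψ) ⊩-cut ⊩-clash

  □-conservative : ∀ {χ} → NoBox χ → □Set Φ ⊢L □ χ → Φ ⊢IPC χ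
  □-conservative {χ} nχ d =
    transport (Φ ⊢IPC_) (trans (cong erase (⟦⟧-noBox nχ)) (erase-noBox-id nχ))
      (⊢⇒⊢IPC Φ-noBox erases ⟦χ⟧)
    where
    -- With nothing assumed necessary, ⟦ [] ⟧ (□ χ) is ⊥, so the guess Δ = [ ⟦ [] ⟧ χ ] is refuted.
    ⟦χ⟧ : Φ⁺ [] ⊢ ⟦ [] ⟧ χ
    ⟦χ⟧ = ∨E (soundness d [] (⟦ [] ⟧ χ ∷ []) (Decided-noBox nχ , inj₂ (here refl)))
            (∨E #0 #0 (⊥E #0)) (⊥E (⇒E #0 ⊤-intro))
    erases : Erases (Φ⁺ []) Φ
    erases (inj₁ p) = transport (Φ ⊢IPC_) (sym (erase-noBox-id (Φ-noBox _ p))) (assm p)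

subst-var : ∀ φ → subst var φ ≡ φ
subst-var (var x) = refl
subst-var bot = refl
subst-var (φ ⇒ ψ) = cong₂ _⇒_ (subst-var φ) (subst-var ψ)
subst-var (φ ∨' ψ) = cong₂ _∨'_ (subst-var φ) (subst-var ψ)
subst-var (φ ∧' ψ) = cong₂ _∧'_ (subst-var φ) (subst-var ψ)
subst-var (□ φ) = cong □ (subst-var φ)

⊢-LAxiom : ∀ (σ : ℕ → Fm) φ → ∅ ⊢ φ → LAxiom (subst σ (erase φ))
⊢-LAxiom σ φ d = taut σ (erase φ) (erase-noBox φ , ⊢⇒⊢IPC (λ _ ()) (λ ()) d)

⟨_,_⟩ : Fm → Fm → ℕ → Fm
⟨ φ , ψ ⟩ y = if y ≡ᵇ 0 then φ else ψ

module _ {Ψ : FmSet} where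

  ∧-intro : Ψ ⊢L φ → Ψ ⊢L ψ → Ψ ⊢L φ ∧' ψ
  ∧-intro {φ} {ψ} dφ dψ =
    mp dψ (mp dφ (ax (⊢-LAxiom ⟨ φ , ψ ⟩ (var 0 ⇒ var 1 ⇒ var 0 ∧' var 1) (⇒I (⇒I (∧I #1 #0))))))

  ∧-elim₁ : Ψ ⊢L φ ∧' ψ → Ψ ⊢L φ
  ∧-elim₁ {φ} {ψ} d = mp d (ax (⊢-LAxiom ⟨ φ , ψ ⟩ (var 0 ∧' var 1 ⇒ var 0) (⇒I (∧E₁ #0))))

  □-transport : Ψ ⊢L □ (φ ⇒ ψ) → Ψ ⊢L □ (ψ ⇒ φ) → Ψ ⊢L □ φ → Ψ ⊢L □ ψ
  □-transport {φ} {ψ} φ⇒ψ ψ⇒φ □φ = mp □φ (mp □[□φ⇒□ψ] (ax (refl□ (□ φ ⇒ □ ψ))))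
    where
    □[□φ⇒□ψ] : Ψ ⊢L □ (□ φ ⇒ □ ψ)
    □[□φ⇒□ψ] = ∧-elim₁ (mp (∧-intro φ⇒ψ ψ⇒φ) (sce φ ψ (□ (var 0)) 0))

  □-⊤⇒-intro : Ψ ⊢L □ (φ ⇒ ⊤' ⇒ φ)
  □-⊤⇒-intro {φ} = nec (⊢-LAxiom (λ _ → φ) (var 0 ⇒ ⊤' ⇒ var 0) (⇒I (⇒I #1)))

  □-⊤⇒-elim : Ψ ⊢L □ ((⊤' ⇒ φ) ⇒ φ)
  □-⊤⇒-elim {φ} = nec (⊢-LAxiom (λ _ → φ) ((⊤' ⇒ var 0) ⇒ var 0) (⇒I (⇒E #0 ⊤-intro)))

  □-mp : Ψ ⊢L □ φ → Ψ ⊢L □ (φ ⇒ ψ) → Ψ ⊢L □ ψ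
  □-mp {φ} {ψ} □φ □φ⇒ψ = □-transport □-⊤⇒-elim □-⊤⇒-intro □⊤⇒ψ
    where
    □⊤⇒ψ : Ψ ⊢L □ (⊤' ⇒ ψ)
    □⊤⇒ψ = mp □φ⇒ψ (mp (□-transport □-⊤⇒-intro □-⊤⇒-elim □φ) (ax (trans□ ⊤' φ ψ)))

IPC⇒□L : Φ ⊢IPC φ → □Set Φ ⊢L □ φ
IPC⇒□L {φ = φ} (assm p) = assm (φ , p , refl)
IPC⇒□L {φ = φ} (ax nφ a) =
  transport (λ ψ → _ ⊢L □ ψ) (subst-var φ) (nec (taut var φ (nφ , ax nφ a)))
IPC⇒□L (mp d e) = □-mp (IPC⇒□L d) (IPC⇒□L e)

theorem5p1 : (Φ : FmSet) (χ : Fm) → (∀ φ → Φ φ → NoBox φ) → NoBox χ →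
    ((□Set Φ ⊢L □ χ) ⇔ (Φ ⊢IPC χ))
theorem5p1 Φ χ Φ-noBox χ-noBox = mk⇔ (Soundness.□-conservative Φ Φ-noBox χ-noBox) IPC⇒□L
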